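{- Let $\mathbf a=a_1a_2\cdots$ be an aperiodic purely morphic word generated by a morphism $\sigma$ defined over a finite alphabet $A$, i.e. $\mathbf a=\sigma^\omega(a)$ for some letter $a$ on which $\sigma$ is prolongable. Set $M=\max\{|\sigma(i)|: i\in A\}$. Then $\mathrm{dio}(\mathbf a)\le M+1$.
   Context: A morphism $\sigma$ of $A^*$ is prolongable on $a\in A$ if $\sigma(a)=aW$ for some word $W$ and $|\sigma^n(a)|\to\infty$; then $\sigma^\omega(a)=\lim_n\sigma^n(a)$ is the infinite fixed point of $\sigma$ starting with $a$ (a purely morphic word). Aperiodic means not eventually periodic. For a finite word $W$ and real $x>0$, $W^x$ denotes $W^{\lfloor x\rfloor}W'$ with $W'$ the prefix of $W$ of length $\lceil\{x\}|W|\rceil$. The Diophantine exponent $\mathrm{dio}(\mathbf a)$ is the supremum of the reals $\rho$ for which there exist arbitrarily long prefixes of $\mathbf a$ of the form $UV^\alpha$ ($U,V$ finite words, $U$ possibly empty, $\alpha$ real) with $|UV^\alpha|/|UV|\ge\rho$. -}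

module Defs where

open import Data.Nat using (ℕ; zero; suc; _+_; _*_; _≤_; _<_; _⊔_)
open import Data.Fin using (Fin; toℕ)
open import Data.List using (List; []; _∷_; _++_; length; map; concatMap; take; foldr; upTo; allFin; lookup)
open import Data.Product using (Σ; ∃; _×_; _,_)
open import Relation.Binary.PropositionalEquality using (_≡_)
open import Relation.Nullary using (¬_)

-- Infinite words over an alphabet A are functions ℕ → A (0-indexed).
-- Prefix of length L of an infinite word, as a finite word.
prefix : {A : Set} → (ℕ → A) → ℕ → List A
prefix x L = map x (upTo L)

apply : {k : ℕ} → (Fin k → List (Fin k)) → List (Fin k) → List (Fin k)
apply σ w = concatMap σ w

iter : {k : ℕ} → (Fin k → List (Fin k)) → ℕ → List (Fin k) → List (Fin k)
iter σ zero    w = w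
iter σ (suc n) w = apply σ (iter σ n w)

Prolongable : {k : ℕ} → (Fin k → List (Fin k)) → Fin k → Set
Prolongable σ a =
  (Σ (List _) λ W → σ a ≡ a ∷ W) ×
  (∀ N → ∃ λ n → N ≤ length (iter σ n (a ∷ [])))

-- x = σ^ω(a) = lim σ^n(a): every σ^n(a) is a prefix of x.
IsFixedPointFrom : {k : ℕ} → (Fin k → List (Fin k)) → Fin k → (ℕ → Fin k) → Set
IsFixedPointFrom σ a x =
  ∀ n → prefix x (length (iter σ n (a ∷ []))) ≡ iter σ n (a ∷ [])

EventuallyPeriodic : {A : Set} → (ℕ → A) → Set
EventuallyPeriodic x = ∃ λ p → ∃ λ n₀ → 1 ≤ p × (∀ i → n₀ ≤ i → x (i + p) ≡ x i)

Aperiodic : {A : Set} → (ℕ → A) → Set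
Aperiodic x = ¬ EventuallyPeriodic x

maxLen : {k : ℕ} → (Fin k → List (Fin k)) → ℕ
maxLen {k} σ = foldr _⊔_ 0 (map (λ i → length (σ i)) (allFin k))

rep : {A : Set} → List A → ℕ → List A
rep V zero    = []
rep V (suc n) = V ++ rep V n

-- The fractional power V^α, indexed by its length m = ⌊α⌋|V| + ⌈{α}|V|⌉:
-- the prefix of length m of VVV⋯ (for nonempty V, rep V m has length ≥ m).
pow : {A : Set} → List A → ℕ → List A
pow V m = take m (rep V m)

DioPrefix : {A : Set} → (ℕ → A) → ℕ → ℕ → ℕ → Set
DioPrefix {A} x p q N =
  Σ (List A) λ U → Σ (List A) λ V → Σ ℕ λ m →
    (1 ≤ length V) ×
    (N ≤ length (U ++ pow V m)) ×
    (prefix x (length (U ++ pow V m)) ≡ U ++ pow V m) ×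
    (p * length (U ++ V) ≤ q * length (U ++ pow V m))

-- ρ = p/q is below dio(x)-witnessing: arbitrarily long such prefixes exist.
Attainable : {A : Set} → (ℕ → A) → ℕ → ℕ → Set
Attainable x p q = ∀ N → DioPrefix x p q N

-- Write s = |U|, p = |V|, L = |U V^α| ≥ (M+1)(s+p), and F t = |σ(x₀ ⋯ x_{t−1})| ≤ M t.
-- The word x has period p on [s, L). Since σ(x) = x, the image of this window shows that x
-- also has period p′ = F(s+p) − F(s) ≤ M p on [F s, F L). Both windows start at least p + p′
-- before L, which lets the period p propagate through the second window up to F L. Because
-- σ lengthens every nonempty prefix of x, F L > L (and p′ > 0), so iterating spreads the
-- period p over all of [s, ∞): x is eventually periodic. A single such prefix already
-- contradicts aperiodicity.
module Submission where

open import Defs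
open import Data.Empty using (⊥-elim)
open import Data.Fin using (Fin)
open import Data.List using (List; []; _∷_; _++_; _∷ʳ_; length; map; concatMap; take; foldr; applyUpTo)
open import Data.List.Membership.Propositional using (_∈_)
open import Data.List.Membership.Propositional.Properties using (∈-allFin)
open import Data.List.Properties using (length-++; length-take; ++-assoc; ++-identityʳ; concatMap-++; map-upTo; applyUpTo-∷ʳ)
open import Data.List.Relation.Unary.Any using (here; there)
open import Data.Maybe using (Maybe; just; nothing)
open import Data.Maybe.Properties using (just-injective)
open import Data.Nat using (ℕ; zero; suc; _+_; _*_; _∸_; _≤_; _<_; _⊔_; z≤n; s≤s; _≤?_; _<?_; >-nonZero)
open import Data.Nat.Induction using (<-rec)
open import Data.Nat.Properties
open import Algebra.Properties.CommutativeSemigroup +-commutativeSemigroup using (xy∙z≈xz∙y)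
open import Data.Nat.Tactic.RingSolver using (solve-∀)
open import Data.Product using (∃; _×_; _,_; proj₂)
open import Data.Sum using (inj₁; inj₂)
open import Function using (_∘_)
open import Relation.Nullary using (¬_; yes; no)
open import Relation.Binary.PropositionalEquality

private
  variable
    A : Set

infixl 5 _!_
_!_ : List A → ℕ → Maybe A
[]      ! _     = nothing
(c ∷ w) ! zero  = just c
(c ∷ w) ! suc i = w ! i

!-++ˡ : (w v : List A) {i : ℕ} → i < length w → (w ++ v) ! i ≡ w ! i
!-++ˡ (c ∷ w) v {zero}  _         = refl
!-++ˡ (c ∷ w) v {suc i} (s≤s i<w) = !-++ˡ w v i<w

!-++ʳ : (w v : List A) (i : ℕ) → (w ++ v) ! (length w + i) ≡ v ! i
!-++ʳ []      v i = refl
!-++ʳ (c ∷ w) v i = !-++ʳ w v i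

!-take : (m : ℕ) (w : List A) {i : ℕ} → i < m → take m w ! i ≡ w ! i
!-take (suc m) []      _         = refl
!-take (suc m) (c ∷ w) {zero}  _ = refl
!-take (suc m) (c ∷ w) {suc i} (s≤s i<m) = !-take m w i<m

rep-suc : (V : List A) (n : ℕ) → rep V (suc n) ≡ rep V n ++ V
rep-suc V zero    = ++-identityʳ V
rep-suc V (suc n) = trans (cong (V ++_) (rep-suc V n)) (sym (++-assoc V (rep V n) V))

≤-length-rep : (V : List A) (n : ℕ) → 1 ≤ length V → n ≤ length (rep V n)
≤-length-rep V zero    _     = z≤n
≤-length-rep V (suc n) 1≤|V| =
  ≤-trans (+-mono-≤ 1≤|V| (≤-length-rep V n 1≤|V|)) (≤-reflexive (sym (length-++ V)))

pow-periodic : (V : List A) (m e : ℕ) → 1 ≤ length V → e + length V < length (pow V m) →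
               pow V m ! (e + length V) ≡ pow V m ! e
pow-periodic V zero    e _     ()
pow-periodic V (suc m) e 1≤|V| e+|V|<|W| = begin
  take (suc m) R ! (e + length V)  ≡⟨ !-take (suc m) R e+|V|<1+m ⟩
  R ! (e + length V)               ≡⟨ cong (R !_) (+-comm e (length V)) ⟩
  (V ++ rep V m) ! (length V + e)  ≡⟨ !-++ʳ V (rep V m) e ⟩
  rep V m ! e                      ≡⟨ sym (!-++ˡ (rep V m) V (≤-trans e<m (≤-length-rep V m 1≤|V|))) ⟩
  (rep V m ++ V) ! e               ≡⟨ cong (_! e) (sym (rep-suc V m)) ⟩
  R ! e                            ≡⟨ sym (!-take (suc m) R (m≤n⇒m≤1+n e<m)) ⟩
  take (suc m) R ! e               ∎
  where
  open ≡-Reasoning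
  R = rep V (suc m)
  e+|V|<1+m : e + length V < suc m
  e+|V|<1+m = <-≤-trans e+|V|<|W| (≤-trans (≤-reflexive (length-take (suc m) R)) (m⊓n≤m (suc m) _))
  e<m : e < m
  e<m = ≤-trans (subst (_≤ e + length V) (+-comm e 1) (+-monoʳ-≤ e 1≤|V|)) (≤-pred e+|V|<1+m)

applyUpTo-+ : (f : ℕ → A) (m n : ℕ) → applyUpTo f (m + n) ≡ applyUpTo f m ++ applyUpTo (λ j → f (m + j)) n
applyUpTo-+ f zero    n = refl
applyUpTo-+ f (suc m) n = cong (f 0 ∷_) (applyUpTo-+ (f ∘ suc) m n)

applyUpTo-! : (f : ℕ → A) {L k : ℕ} → k < L → applyUpTo f L ! k ≡ just (f k)
applyUpTo-! f {suc L} {zero}  _         = refl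
applyUpTo-! f {suc L} {suc k} (s≤s k<L) = applyUpTo-! (f ∘ suc) k<L

prefix-! : (x : ℕ → A) {L k : ℕ} → k < L → prefix x L ! k ≡ just (x k)
prefix-! x {L} {k} k<L = trans (cong (_! k) (map-upTo x L)) (applyUpTo-! x k<L)

prefix-suc : (x : ℕ → A) (t : ℕ) → prefix x (suc t) ≡ prefix x t ∷ʳ x t
prefix-suc x t = begin
  prefix x (suc t)       ≡⟨ map-upTo x (suc t) ⟩
  applyUpTo x (suc t)    ≡⟨ sym (applyUpTo-∷ʳ x t) ⟩
  applyUpTo x t ∷ʳ x t   ≡⟨ cong (_∷ʳ x t) (sym (map-upTo x t)) ⟩
  prefix x t ∷ʳ x t      ∎
  where open ≡-Reasoning

prefix-∷ : (x : ℕ → A) {i L : ℕ} → i < L → ∃ λ u → prefix x L ≡ prefix x i ++ x i ∷ u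
prefix-∷ x {i} i<L with m≤n⇒∃[o]m+o≡n i<L
... | d , refl = u , (begin
  prefix x (suc i + d)                ≡⟨ map-upTo x (suc i + d) ⟩
  applyUpTo x (suc i + d)             ≡⟨ applyUpTo-+ x (suc i) d ⟩
  applyUpTo x (suc i) ++ u            ≡⟨ cong (_++ u) (trans (sym (map-upTo x (suc i))) (prefix-suc x i)) ⟩
  (prefix x i ∷ʳ x i) ++ u            ≡⟨ ++-assoc (prefix x i) (x i ∷ []) u ⟩
  prefix x i ++ x i ∷ u               ∎)
  where
  open ≡-Reasoning
  u = applyUpTo (λ j → x (suc i + j)) d

crossing : (f : ℕ → ℕ) {s L j : ℕ} → s ≤ L → f s ≤ j → j < f L →
           ∃ λ i → s ≤ i × i < L × f i ≤ j × j < f (suc i)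
crossing f {L = zero} z≤n fs≤j j<fL = ⊥-elim (<⇒≱ j<fL fs≤j)
crossing f {s} {suc L} {j} s≤1+L fs≤j j<fL with m≤n⇒m<n∨m≡n s≤1+L
... | inj₂ refl = ⊥-elim (<⇒≱ j<fL fs≤j)
... | inj₁ (s≤s s≤L) with f L ≤? j
...   | yes fL≤j = L , s≤L , ≤-refl , fL≤j , j<fL
...   | no  fL≰j with crossing f s≤L fs≤j (≰⇒> fL≰j)
...     | i , s≤i , i<L , below = i , s≤i , m≤n⇒m≤1+n i<L , below

PeriodicOn : (ℕ → A) → ℕ → ℕ → ℕ → Set
PeriodicOn x p s L = ∀ i → s ≤ i → i + p < L → x (i + p) ≡ x i

periodicOn-≤ : {x : ℕ → A} {p s L L′ : ℕ} → L′ ≤ L → PeriodicOn x p s L → PeriodicOn x p s L′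
periodicOn-≤ L′≤L per i s≤i i+p<L′ = per i s≤i (<-≤-trans i+p<L′ L′≤L)

periodicOn-all⇒eventuallyPeriodic : {x : ℕ → A} {p s : ℕ} → 1 ≤ p → (∀ L → PeriodicOn x p s L) →
                                     EventuallyPeriodic x
periodicOn-all⇒eventuallyPeriodic {p = p} {s} 1≤p per = p , s , 1≤p , λ i s≤i → per (suc (i + p)) i s≤i ≤-refl

periodicOn-glue : {x : ℕ → A} {p q s t L L′ : ℕ} → 1 ≤ q →
                  PeriodicOn x p s L → PeriodicOn x q t L′ →
                  s + q + p ≤ L → t + q + p ≤ L → PeriodicOn x p s L′
periodicOn-glue {x = x} {p} {q} {s} {t} {L} {L′} 1≤q perL perL′ s+q+p≤L t+q+p≤L =
  <-rec (λ i → s ≤ i → i + p < L′ → x (i + p) ≡ x i) glued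
  where
  glued : ∀ i → (∀ {j} → j < i → s ≤ j → j + p < L′ → x (j + p) ≡ x j) →
          s ≤ i → i + p < L′ → x (i + p) ≡ x i
  glued i rec s≤i i+p<L′ with i + p <? L
  ... | yes i+p<L = perL i s≤i i+p<L
  ... | no  i+p≮L = begin
    x (i + p)      ≡⟨ cong x (sym j+p+q≡i+p) ⟩
    x (j + p + q)  ≡⟨ perL′ (j + p) (≤-trans (before t+q+p≤L) (m≤m+n j p))
                              (subst (_< L′) (sym j+p+q≡i+p) i+p<L′) ⟩
    x (j + p)      ≡⟨ rec j<i (before s+q+p≤L) (<-trans (+-monoˡ-< p j<i) i+p<L′) ⟩
    x j            ≡⟨ sym (perL′ j (before t+q+p≤L)
                              (subst (_< L′) (sym j+q≡i) (≤-<-trans (m≤m+n i p) i+p<L′))) ⟩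
    x (j + q)      ≡⟨ cong x j+q≡i ⟩
    x i            ∎
    where
    open ≡-Reasoning
    past : ∀ {u} → u + q + p ≤ L → u + q ≤ i
    past u+q+p≤L = +-cancelʳ-≤ p _ i (≤-trans u+q+p≤L (≮⇒≥ i+p≮L))
    j = i ∸ q
    j+q≡i : j + q ≡ i
    j+q≡i = m∸n+n≡m (≤-trans (m≤n+m q t) (past t+q+p≤L))
    before : ∀ {u} → u + q + p ≤ L → u ≤ j
    before u+q+p≤L = m+n≤o⇒m≤o∸n _ (past u+q+p≤L)
    j<i : j < i
    j<i = subst (j <_) j+q≡i (m<m+n j 1≤q)
    j+p+q≡i+p : j + p + q ≡ i + p
    j+p+q≡i+p = trans (xy∙z≈xz∙y j p q) (cong (_+ p) j+q≡i)

prefix-pow⇒periodicOn : (x : ℕ → A) (U V : List A) (m : ℕ) → 1 ≤ length V →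
                        prefix x (length (U ++ pow V m)) ≡ U ++ pow V m →
                        PeriodicOn x (length V) (length U) (length (U ++ pow V m))
prefix-pow⇒periodicOn x U V m 1≤|V| isPrefix i |U|≤i i+|V|<L with m≤n⇒∃[o]m+o≡n |U|≤i
... | e , refl = just-injective (begin
  just (x (length U + e + length V))       ≡⟨ sym (letter i+|V|<L) ⟩
  (U ++ W) ! (length U + e + length V)     ≡⟨ cong ((U ++ W) !_) (+-assoc (length U) e (length V)) ⟩
  (U ++ W) ! (length U + (e + length V))   ≡⟨ !-++ʳ U W (e + length V) ⟩
  W ! (e + length V)                       ≡⟨ pow-periodic V m e 1≤|V| e+|V|<|W| ⟩
  W ! e                                    ≡⟨ sym (!-++ʳ U W e) ⟩
  (U ++ W) ! (length U + e)                ≡⟨ letter (≤-<-trans (m≤m+n (length U + e) (length V)) i+|V|<L) ⟩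
  just (x (length U + e))                  ∎)
  where
  open ≡-Reasoning
  W = pow V m
  letter : ∀ {k} → k < length (U ++ W) → (U ++ W) ! k ≡ just (x k)
  letter {k} k<L = trans (cong (_! k) (sym isPrefix)) (prefix-! x k<L)
  e+|V|<|W| : e + length V < length W
  e+|V|<|W| = +-cancelˡ-< (length U) _ _
                (subst₂ _<_ (+-assoc (length U) e (length V)) (length-++ U) i+|V|<L)

≤-foldr-⊔ : {B : Set} (f : B → ℕ) {b : B} {bs : List B} → b ∈ bs → f b ≤ foldr _⊔_ 0 (map f bs)
≤-foldr-⊔ f (here refl) = m≤m⊔n _ _
≤-foldr-⊔ f {bs = b′ ∷ _} (there b∈bs) = ≤-trans (≤-foldr-⊔ f b∈bs) (m≤n⊔m (f b′) _)

length≤maxLen : {k : ℕ} (σ : Fin k → List (Fin k)) (c : Fin k) → length (σ c) ≤ maxLen σ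
length≤maxLen σ c = ≤-foldr-⊔ (length ∘ σ) (∈-allFin c)

≤-of-ratio : {c q r n L : ℕ} → 1 ≤ q → c * q ≤ r → r * n ≤ q * L → c * n ≤ L
≤-of-ratio {c} {q} {r} {n} {L} 1≤q cq≤r rn≤qL = *-cancelˡ-≤ q {{>-nonZero 1≤q}} (begin
  q * (c * n)  ≡⟨ sym (*-assoc q c n) ⟩
  q * c * n    ≡⟨ cong (_* n) (*-comm q c) ⟩
  c * q * n    ≤⟨ *-monoˡ-≤ n cq≤r ⟩
  r * n        ≤⟨ rn≤qL ⟩
  q * L        ∎)
  where open ≤-Reasoning

private
  +-*-rearrange : ∀ s p M → s + M * s + M * p + p ≡ suc M * (s + p)
  +-*-rearrange = solve-∀

module Image (σ : A → List A) (x : ℕ → A) where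

  imageLength : ℕ → ℕ
  imageLength zero    = 0
  imageLength (suc i) = imageLength i + length (σ (x i))

  imagePeriod : ℕ → ℕ → ℕ
  imagePeriod s p = imageLength (s + p) ∸ imageLength s

  -- σ(x) = x read letter by letter: σ(x_i) occurs in x at position |σ(x_0 ⋯ x_{i-1})|.
  IsFixedPoint : Set
  IsFixedPoint = ∀ i {r} → r < length (σ (x i)) → σ (x i) ! r ≡ just (x (imageLength i + r))

  Expanding : Set
  Expanding = ∀ L → 1 ≤ L → L < imageLength L

  length-concatMap-prefix : ∀ t → length (concatMap σ (prefix x t)) ≡ imageLength t
  length-concatMap-prefix zero    = refl
  length-concatMap-prefix (suc t) = begin
    length (concatMap σ (prefix x (suc t)))                 ≡⟨ cong (length ∘ concatMap σ) (prefix-suc x t) ⟩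
    length (concatMap σ (prefix x t ++ x t ∷ []))           ≡⟨ cong length (concatMap-++ σ (prefix x t) (x t ∷ [])) ⟩
    length (concatMap σ (prefix x t) ++ σ (x t) ++ [])      ≡⟨ length-++ (concatMap σ (prefix x t)) ⟩
    length (concatMap σ (prefix x t)) + length (σ (x t) ++ []) ≡⟨ cong₂ _+_ (length-concatMap-prefix t)
                                                                         (cong length (++-identityʳ (σ (x t)))) ⟩
    imageLength t + length (σ (x t))                        ∎
    where open ≡-Reasoning

  imageLength-mono : ∀ {i j} → i ≤ j → imageLength i ≤ imageLength j
  imageLength-mono {j = zero}  z≤n   = ≤-refl
  imageLength-mono {j = suc j} i≤1+j with m≤n⇒m<n∨m≡n i≤1+j
  ... | inj₁ (s≤s i≤j) = ≤-trans (imageLength-mono i≤j) (m≤m+n _ _)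
  ... | inj₂ refl      = ≤-refl

  imageLength-+-≤ : ∀ {M} → (∀ c → length (σ c) ≤ M) → ∀ i d → imageLength (i + d) ≤ imageLength i + M * d
  imageLength-+-≤ {M} bound i zero =
    ≤-reflexive (trans (cong imageLength (+-identityʳ i)) (sym (trans (cong (imageLength i +_) (*-zeroʳ M)) (+-identityʳ _))))
  imageLength-+-≤ {M} bound i (suc d) = begin
    imageLength (i + suc d)                       ≡⟨ cong imageLength (+-suc i d) ⟩
    imageLength (i + d) + length (σ (x (i + d)))  ≤⟨ +-mono-≤ (imageLength-+-≤ bound i d) (bound (x (i + d))) ⟩
    imageLength i + M * d + M                     ≡⟨ +-assoc (imageLength i) (M * d) M ⟩
    imageLength i + (M * d + M)                   ≡⟨ cong (imageLength i +_) (trans (+-comm (M * d) M) (sym (*-suc M d))) ⟩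
    imageLength i + M * suc d                     ∎
    where open ≤-Reasoning

  imagePeriod-≤ : ∀ {M} → (∀ c → length (σ c) ≤ M) → ∀ s p → imagePeriod s p ≤ M * p
  imagePeriod-≤ {M} bound s p = ≤-trans (∸-monoˡ-≤ (imageLength s) (imageLength-+-≤ bound s p))
                                        (≤-reflexive (m+n∸m≡n (imageLength s) (M * p)))

  imageLength-shift : ∀ {p s L i} → PeriodicOn x p s L → s ≤ i → i + p ≤ L →
                      imageLength (i + p) ≡ imageLength i + imagePeriod s p
  imageLength-shift {p} {s} {L} per s≤i i+p≤L with m≤n⇒∃[o]m+o≡n s≤i
  ... | d , refl = shifted d i+p≤L
    where
    open ≡-Reasoning
    p′ = imagePeriod s p
    shifted : ∀ d → s + d + p ≤ L → imageLength (s + d + p) ≡ imageLength (s + d) + p′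
    shifted zero _ rewrite +-identityʳ s = sym (m+[n∸m]≡n (imageLength-mono (m≤m+n s p)))
    shifted (suc d) s+d+p<L = begin
      imageLength (s + suc d + p)                             ≡⟨ cong (λ n → imageLength (n + p)) (+-suc s d) ⟩
      imageLength (s + d + p) + length (σ (x (s + d + p)))    ≡⟨ cong₂ _+_ (shifted d (<⇒≤ s+d+p<L′))
                                                                  (cong (length ∘ σ) (per (s + d) (m≤m+n s d) s+d+p<L′)) ⟩
      imageLength (s + d) + p′ + length (σ (x (s + d)))       ≡⟨ xy∙z≈xz∙y (imageLength (s + d)) p′ _ ⟩
      imageLength (s + d) + length (σ (x (s + d))) + p′       ≡⟨ cong (λ n → imageLength n + p′) (sym (+-suc s d)) ⟩
      imageLength (s + suc d) + p′                            ∎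
      where
      s+d+p<L′ : s + d + p < L
      s+d+p<L′ = subst (_≤ L) (cong (_+ p) (+-suc s d)) s+d+p<L

  imageLetter-periodic : ∀ {p s L i r} → IsFixedPoint → PeriodicOn x p s L → s ≤ i → i + p < L →
                         r < length (σ (x i)) →
                         x (imageLength i + r + imagePeriod s p) ≡ x (imageLength i + r)
  imageLetter-periodic {p} {s} {L} {i} {r} fixed per s≤i i+p<L r<|σxi| = just-injective (begin
    just (x (imageLength i + r + p′))   ≡⟨ cong (just ∘ x) (xy∙z≈xz∙y (imageLength i) r p′) ⟩
    just (x (imageLength i + p′ + r))   ≡⟨ cong (λ n → just (x (n + r))) (sym (imageLength-shift per s≤i (<⇒≤ i+p<L))) ⟩
    just (x (imageLength (i + p) + r))  ≡⟨ sym (fixed (i + p) (subst (λ c → r < length (σ c)) (sym xi+p≡xi) r<|σxi|)) ⟩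
    σ (x (i + p)) ! r                   ≡⟨ cong (λ c → σ c ! r) xi+p≡xi ⟩
    σ (x i) ! r                         ≡⟨ fixed i r<|σxi| ⟩
    just (x (imageLength i + r))        ∎)
    where
    open ≡-Reasoning
    p′ = imagePeriod s p
    xi+p≡xi = per i s≤i i+p<L

  periodicOn-image : ∀ {p s L} → IsFixedPoint → PeriodicOn x p s L → s + p ≤ L →
                     PeriodicOn x (imagePeriod s p) (imageLength s) (imageLength L)
  periodicOn-image {p} {s} {L} fixed per s+p≤L j Fs≤j j+p′<FL
    with crossing imageLength s≤L₀ Fs≤j (+-cancelʳ-< p′ j _ (subst (j + p′ <_) FL≡FL₀+p′ j+p′<FL))
    where
    p′ = imagePeriod s p
    L₀ = L ∸ p
    s≤L₀ : s ≤ L₀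
    s≤L₀ = m+n≤o⇒m≤o∸n s s+p≤L
    L₀+p≡L : L₀ + p ≡ L
    L₀+p≡L = m∸n+n≡m (≤-trans (m≤n+m p s) s+p≤L)
    FL≡FL₀+p′ : imageLength L ≡ imageLength L₀ + p′
    FL≡FL₀+p′ = trans (cong imageLength (sym L₀+p≡L)) (imageLength-shift per s≤L₀ (≤-reflexive L₀+p≡L))
  ... | i , s≤i , i<L₀ , Fi≤j , j<F[1+i] with m≤n⇒∃[o]m+o≡n Fi≤j
  ... | r , refl = imageLetter-periodic fixed per s≤i
                     (m≤o∸n⇒m+n≤o (suc i) (≤-trans (m≤n+m p s) s+p≤L) i<L₀)
                     (+-cancelˡ-< (imageLength i) r _ j<F[1+i])

  imageLength-bounded : ∀ {p s L} → imagePeriod s p ≡ 0 → 1 ≤ p → PeriodicOn x p s L →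
                        ∀ i → s ≤ i → i ≤ L → imageLength i ≤ imageLength (s + p)
  imageLength-bounded {p} {s} {L} p′≡0 1≤p per = <-rec P bounded
    where
    P : ℕ → Set
    P i = s ≤ i → i ≤ L → imageLength i ≤ imageLength (s + p)
    bounded : ∀ i → (∀ {j} → j < i → P j) → P i
    bounded i rec s≤i i≤L with i ≤? s + p
    ... | yes i≤s+p = imageLength-mono i≤s+p
    ... | no  i≰s+p = begin
      imageLength i                     ≡⟨ cong imageLength (sym j+p≡i) ⟩
      imageLength (j + p)               ≡⟨ imageLength-shift per s≤j (≤-trans (≤-reflexive j+p≡i) i≤L) ⟩
      imageLength j + imagePeriod s p   ≡⟨ trans (cong (imageLength j +_) p′≡0) (+-identityʳ _) ⟩
      imageLength j                     ≤⟨ rec j<i s≤j (≤-trans (<⇒≤ j<i) i≤L) ⟩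
      imageLength (s + p)               ∎
      where
      open ≤-Reasoning
      s+p<i = ≰⇒> i≰s+p
      j = i ∸ p
      j+p≡i : j + p ≡ i
      j+p≡i = m∸n+n≡m (≤-trans (m≤n+m p s) (<⇒≤ s+p<i))
      s≤j : s ≤ j
      s≤j = m+n≤o⇒m≤o∸n s (<⇒≤ s+p<i)
      j<i : j < i
      j<i = subst (j <_) j+p≡i (m<m+n j 1≤p)

  imagePeriod-positive : ∀ {M p s L} → Expanding → (∀ c → length (σ c) ≤ M) → 1 ≤ p →
                         PeriodicOn x p s L → suc M * (s + p) ≤ L → 1 ≤ imagePeriod s p
  imagePeriod-positive {M} {p} {s} {L} expanding bound 1≤p per long with imagePeriod s p in p′≡
  ... | suc _ = s≤s z≤n
  ... | zero  = ⊥-elim (<⇒≱ (expanding L (≤-trans 1≤p p≤L)) FL≤L)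
    where
    s+p≤L : s + p ≤ L
    s+p≤L = ≤-trans (m≤m+n (s + p) _) long
    p≤L = ≤-trans (m≤n+m p s) s+p≤L
    FL≤L : imageLength L ≤ L
    FL≤L = begin
      imageLength L        ≤⟨ imageLength-bounded p′≡ 1≤p per L (≤-trans (m≤m+n s p) s+p≤L) ≤-refl ⟩
      imageLength (s + p)  ≤⟨ imageLength-+-≤ bound 0 (s + p) ⟩
      M * (s + p)          ≤⟨ m≤n+m _ (s + p) ⟩
      suc M * (s + p)      ≤⟨ long ⟩
      L                    ∎
      where open ≤-Reasoning

  long-repetition⇒eventuallyPeriodic : ∀ {M p s L} → IsFixedPoint → Expanding → (∀ c → length (σ c) ≤ M) →
                                        1 ≤ p → PeriodicOn x p s L → suc M * (s + p) ≤ L → EventuallyPeriodic x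
  long-repetition⇒eventuallyPeriodic {M} {p} {s} {L} fixed expanding bound 1≤p per long =
    periodicOn-all⇒eventuallyPeriodic 1≤p periodicOn-all
    where
    p′ = imagePeriod s p
    fits : ∀ {a} → a ≤ s + M * s → a + p′ + p ≤ L
    fits {a} a≤ = begin
      a + p′ + p               ≤⟨ +-monoˡ-≤ p (+-mono-≤ a≤ (imagePeriod-≤ bound s p)) ⟩
      s + M * s + M * p + p    ≡⟨ +-*-rearrange s p M ⟩
      suc M * (s + p)          ≤⟨ long ⟩
      L                        ∎
      where open ≤-Reasoning
    window-fits : s + p′ + p ≤ L
    window-fits = fits (m≤m+n s (M * s))
    image-fits : imageLength s + p′ + p ≤ L
    image-fits = fits (≤-trans (imageLength-+-≤ bound 0 s) (m≤n+m (M * s) s))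
    step : ∀ {N} → L ≤ N → PeriodicOn x p s N → PeriodicOn x p s (imageLength N)
    step L≤N perN = periodicOn-glue (imagePeriod-positive expanding bound 1≤p per long) perN
                      (periodicOn-image fixed perN (≤-trans (+-monoˡ-≤ p (m≤m+n s p′)) (≤-trans window-fits L≤N)))
                      (≤-trans window-fits L≤N) (≤-trans image-fits L≤N)
    periodicOn-all : ∀ N → PeriodicOn x p s N
    periodicOn-all zero = periodicOn-≤ z≤n per
    periodicOn-all (suc N) with suc N ≤? L
    ... | yes 1+N≤L = periodicOn-≤ 1+N≤L per
    ... | no  1+N≰L = periodicOn-≤ (expanding N (≤-trans 1≤L L≤N)) (step L≤N (periodicOn-all N))
      where
      L≤N = ≤-pred (≰⇒> 1+N≰L)
      1≤L = ≤-trans 1≤p (≤-trans (m≤n+m p s) (≤-trans (m≤m+n (s + p) _) long))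

open Image

module _ {k : ℕ} (σ : Fin k → List (Fin k)) (a : Fin k) (x : ℕ → Fin k)
         (prolongable : Prolongable σ a) (fixedPoint : IsFixedPointFrom σ a x) where

  private
    iterLength : ℕ → ℕ
    iterLength n = length (iter σ n (a ∷ []))

  imageLength-iter : ∀ n → imageLength σ x (iterLength n) ≡ iterLength (suc n)
  imageLength-iter n = trans (sym (length-concatMap-prefix σ x (iterLength n)))
                             (cong (length ∘ concatMap σ) (fixedPoint n))

  prefixes⇒expanding : Expanding σ x
  prefixes⇒expanding L 1≤L with proj₂ prolongable (suc L)
  ... | N , L<lN with crossing iterLength {L = N} z≤n 1≤L L<lN
  ... | n , _ , _ , ln≤L , L<l[1+n] =
    <-≤-trans L<l[1+n] (≤-trans (≤-reflexive (sym (imageLength-iter n))) (imageLength-mono σ x ln≤L))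

  prefixes⇒isFixedPoint : IsFixedPoint σ x
  prefixes⇒isFixedPoint i {r} r<|σxi| with proj₂ prolongable (suc i)
  ... | n , i<ln with prefix-∷ x i<ln
  ... | u , prefix≡ = begin
    σ (x i) ! r                                           ≡⟨ sym (!-++ˡ (σ (x i)) (concatMap σ u) r<|σxi|) ⟩
    (σ (x i) ++ concatMap σ u) ! r                        ≡⟨ sym (!-++ʳ B _ r) ⟩
    (B ++ σ (x i) ++ concatMap σ u) ! (length B + r)      ≡⟨ cong₂ _!_ (sym (concatMap-++ σ (prefix x i) (x i ∷ u)))
                                                                   (cong (_+ r) (length-concatMap-prefix σ x i)) ⟩
    concatMap σ (prefix x i ++ x i ∷ u) ! (F i + r)       ≡⟨ cong (λ w → concatMap σ w ! (F i + r)) (sym prefix≡) ⟩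
    concatMap σ (prefix x (iterLength n)) ! (F i + r)     ≡⟨ cong (λ w → concatMap σ w ! (F i + r)) (fixedPoint n) ⟩
    iter σ (suc n) (a ∷ []) ! (F i + r)                   ≡⟨ cong (_! (F i + r)) (sym (fixedPoint (suc n))) ⟩
    prefix x (iterLength (suc n)) ! (F i + r)             ≡⟨ prefix-! x F[i]+r<l[1+n] ⟩
    just (x (F i + r))                                    ∎
    where
    open ≡-Reasoning
    F = imageLength σ x
    B = concatMap σ (prefix x i)
    F[i]+r<l[1+n] : F i + r < iterLength (suc n)
    F[i]+r<l[1+n] = <-≤-trans (+-monoʳ-< (F i) r<|σxi|)
                      (≤-trans (imageLength-mono σ x i<ln) (≤-reflexive (imageLength-iter n)))

proposition6p2 : {k : ℕ} (σ : Fin k → List (Fin k)) (a : Fin k) (x : ℕ → Fin k) →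
    Prolongable σ a → IsFixedPointFrom σ a x → Aperiodic x →
    (p q : ℕ) → 1 ≤ q → suc (maxLen σ) * q < p →
    ¬ Attainable x p q
proposition6p2 σ a x prolongable fixedPoint aperiodic p q 1≤q ratio attainable
  with attainable 0
... | U , V , m , 1≤|V| , _ , isPrefix , p|UV|≤q|UW| =
  aperiodic (long-repetition⇒eventuallyPeriodic σ x
    (prefixes⇒isFixedPoint σ a x prolongable fixedPoint)
    (prefixes⇒expanding σ a x prolongable fixedPoint)
    (length≤maxLen σ) 1≤|V|
    (prefix-pow⇒periodicOn x U V m 1≤|V| isPrefix)
    (≤-of-ratio {c = suc (maxLen σ)} 1≤q (<⇒≤ ratio) (subst (λ n → p * n ≤ q * length (U ++ pow V m)) (length-++ U) p|UV|≤q|UW|)))
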